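{- For the maximum priority flow problem with unit edge capacities on a graph with $m$ edges, the greedy algorithm that repeatedly selects a demand having a shortest feasible path (with respect to priorities) in the current residual graph, routes it on that path, and deletes the path's edges from the graph, yields an $O(\sqrt{m})$-approximation.
   Context: In the maximum priority flow problem we are given a graph $G=(V,E)$ (directed or undirected) with $m$ edges, a sink $t$, and unit demands, demand $i$ located at a source $s_i$ and to be routed to $t$. The edge set is partitioned into priority classes $E_1,E_2,\ldots$, and each demand has a priority level; a demand of priority $i$ may only be routed along a path using edges in $E_1\cup\cdots\cup E_i$ (such a path is feasible for it). Here each edge can be used by at most one routed demand. The goal is to maximize the number of routed demands. -}

module Defs where

open import Data.Bool using (Bool; true; false)
open import Data.Nat using (ℕ; _≤_)
open import Data.Fin using (Fin)
open import Data.List using (List; []; _∷_; _++_; length; map; concatMap)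
open import Data.List.Relation.Unary.All using (All)
open import Data.List.Relation.Unary.Unique.Propositional using (Unique)
open import Data.List.Membership.Propositional using (_∈_; _∉_)
open import Data.Product using (_×_; _,_; proj₁; proj₂)
open import Relation.Binary.PropositionalEquality using (_≡_)
open import Relation.Nullary using (¬_)

-- Vertices are Fin n, edges are Fin m (parallel edges allowed), edge e joins
-- tail e and head e (directed from tail to head when `directed = true`).
-- cls e is the priority class i with e ∈ E_i.  There are k unit demands;
-- demand d sits at source src d and has priority level prio d; all go to sink t.
record Instance : Set where
  field
    directed : Bool
    n m k    : ℕ
    tail head : Fin m → Fin n
    cls      : Fin m → ℕ
    t        : Fin n
    src      : Fin k → Fin n
    prio     : Fin k → ℕ

module _ (I : Instance) where
  open Instance I

  data Traverse : Bool → Fin m → Fin n → Fin n → Set where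
    forward  : ∀ {b e} → Traverse b e (tail e) (head e)
    backward : ∀ {e} → Traverse false e (head e) (tail e)

  data Walk : Fin n → Fin n → List (Fin m) → Set where
    nil  : ∀ {v} → Walk v v []
    cons : ∀ {u w v e es} → Traverse directed e u w → Walk w v es → Walk u v (e ∷ es)

  -- p is a feasible path for demand d in the residual graph obtained by
  -- deleting the edges U: a walk from src d to t using no edge twice,
  -- only edges of classes ≤ prio d, and no edge of U.
  Feasible : Fin k → List (Fin m) → List (Fin m) → Set
  Feasible d U p =
    Walk (src d) t p × Unique p × All (λ e → cls e ≤ prio d) p × All (λ e → e ∉ U) p

  Routing : List (Fin k × List (Fin m)) → Set
  Routing R =
    Unique (map proj₁ R) × Unique (concatMap proj₂ R) × All (λ dp → Feasible (proj₁ dp) [] (proj₂ dp)) R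

  -- GreedyFrom D U run: starting with routed demands D and deleted edges U,
  -- `run` is a complete execution of the greedy algorithm: each step picks an
  -- unrouted demand d and a feasible path p for it in the residual graph whose
  -- length is minimum over all unrouted demands and all their feasible paths,
  -- routes d on p, and deletes p's edges; it stops when no unrouted demand has
  -- a feasible path.  (Arbitrary tie-breaking.)
  data GreedyFrom : List (Fin k) → List (Fin m) → List (Fin k × List (Fin m)) → Set where
    done : ∀ {D U} →
           (∀ d → d ∉ D → ∀ q → ¬ Feasible d U q) →
           GreedyFrom D U []
    step : ∀ {D U d p rest} →
           d ∉ D → Feasible d U p →
           (∀ d′ → d′ ∉ D → ∀ q → Feasible d′ U q → length p ≤ length q) →
           GreedyFrom (d ∷ D) (p ++ U) rest →
           GreedyFrom D U ((d , p) ∷ rest)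

  GreedyRun : List (Fin k × List (Fin m)) → Set
  GreedyRun = GreedyFrom [] []

module Submission where

-- Fix a scale a ≈ √(m+1).  A demand routed by a routing R either has a long path (≥ a edges), or is
-- routed by greedy, or has a short path p that greedy left unused.  Edge-disjointness allows fewer
-- than 4a long paths, and there are at most |G| demands of the second kind.  For the third kind, greedy
-- chose a path no longer than p sharing an edge with p; charging the demand to that edge charges
-- edge-disjoint paths to distinct edges of short greedy paths, of which there are at most a|G|.
-- Hence |R| ≤ 4a + |G| + a|G| ≤ 6a|G|, and squaring gives |R|² ≤ 36(m+1)|G|².

open import Defs
open import Data.Bool using (true; false)
open import Data.Empty using (⊥-elim)
open import Data.Fin using (Fin)
import Data.Fin.Properties as Fin
open import Data.List using (List; []; _∷_; _++_; length; map; concatMap; filter)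
open import Data.List.Properties
  using (length-++; length-map; length-tabulate; length-removeAt′; length-filter;
         filter-accept; filter-reject; filter-++; filter-some)
open import Data.List.Membership.Propositional using (_∈_; _∉_; _─_)
open import Data.List.Membership.Propositional.Properties
  using (∈-++⁻; ∈-allFin; ∈-filter⁺; ∈-filter⁻; ∈-map⁺; ∈-concat⁺′)
import Data.List.Membership.DecPropositional as DecMembership
open import Data.List.Relation.Binary.Subset.Propositional using (_⊆_)
open import Data.List.Relation.Unary.All as All using (All; []; _∷_)
open import Data.List.Relation.Unary.All.Properties using (all-filter; ¬Any⇒All¬)
open import Data.List.Relation.Unary.AllPairs using ([]; _∷_)
open import Data.List.Relation.Unary.Any as Any using (Any; here; there; any?; index)
open import Data.List.Relation.Unary.Unique.Propositional using (Unique)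
open import Data.List.Relation.Unary.Unique.Propositional.Properties using (filter⁺)
open import Data.Nat using (ℕ; zero; suc; _+_; _*_; _≤_; _<_; z≤n; s≤s; _≤?_; _<?_; >-nonZero)
open import Data.Nat.Properties
open import Data.Nat.Tactic.RingSolver using (solve-∀)
open import Data.Product using (Σ; ∃-syntax; _×_; _,_; proj₁; proj₂)
open import Data.Sum using (_⊎_; inj₁; inj₂; [_,_])
open import Function using (_∘_; id)
open import Level using (0ℓ)
open import Relation.Binary.Definitions using (DecidableEquality)
open import Relation.Binary.PropositionalEquality using (_≡_; _≢_; refl; sym; cong)
open import Relation.Nullary using (Dec; does; yes; no)
open import Relation.Unary using (Pred; Decidable)

module _ {A : Set} where

  ∈-─⁺ : ∀ {x y : A} {ys} (x∈ys : x ∈ ys) → y ∈ ys → y ≢ x → y ∈ ys ─ x∈ys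
  ∈-─⁺ (here refl) (here refl) y≢x = ⊥-elim (y≢x refl)
  ∈-─⁺ (here _)    (there y∈)  _   = y∈
  ∈-─⁺ (there _)   (here refl) _   = here refl
  ∈-─⁺ (there x∈)  (there y∈)  y≢x = there (∈-─⁺ x∈ y∈ y≢x)

  unique-⊆⇒length≤ : ∀ {xs ys : List A} → Unique xs → xs ⊆ ys → length xs ≤ length ys
  unique-⊆⇒length≤ [] _ = z≤n
  unique-⊆⇒length≤ {x ∷ xs} {ys} (x∉xs ∷ uxs) xs⊆ys = begin
    suc (length xs)          ≤⟨ s≤s (unique-⊆⇒length≤ uxs xs⊆ys─x) ⟩
    suc (length (ys ─ x∈ys)) ≡⟨ length-removeAt′ ys (index x∈ys) ⟨
    length ys                ∎
    where
    open ≤-Reasoning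
    x∈ys = xs⊆ys (here refl)
    xs⊆ys─x : xs ⊆ ys ─ x∈ys
    xs⊆ys─x y∈xs = ∈-─⁺ x∈ys (xs⊆ys (there y∈xs)) (λ y≡x → All.lookup x∉xs y∈xs (sym y≡x))

  ∉-++⁺ : ∀ {x : A} {xs ys} → x ∉ xs → x ∉ ys → x ∉ xs ++ ys
  ∉-++⁺ {xs = xs} x∉xs x∉ys = [ x∉xs , x∉ys ] ∘ ∈-++⁻ xs

  length-filter-∈≤ : (_≟_ : DecidableEquality A) → let open DecMembership _≟_ in
                     ∀ {xs} ys → Unique xs → length (filter (_∈? ys) xs) ≤ length ys
  length-filter-∈≤ _≟_ {xs} ys u =
    unique-⊆⇒length≤ (filter⁺ (_∈? ys) u) (proj₂ ∘ ∈-filter⁻ (_∈? ys) {xs = xs})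
    where open DecMembership _≟_

unique⇒length≤card : ∀ {m} {xs : List (Fin m)} → Unique xs → length xs ≤ m
unique⇒length≤card u =
  ≤-trans (unique-⊆⇒length≤ u (λ {x} _ → ∈-allFin x)) (≤-reflexive (length-tabulate id))

module _ {A B : Set} (f : A → List B) where

  length-concatMap≤ : ∀ {a xs} → All (λ x → length (f x) ≤ a) xs →
                      length (concatMap f xs) ≤ length xs * a
  length-concatMap≤ [] = z≤n
  length-concatMap≤ {xs = x ∷ xs} (fx≤a ∷ fxs≤a) = begin
    length (f x ++ concatMap f xs)          ≡⟨ length-++ (f x) ⟩
    length (f x) + length (concatMap f xs)  ≤⟨ +-mono-≤ fx≤a (length-concatMap≤ fxs≤a) ⟩
    _ + length xs * _                       ∎
    where open ≤-Reasoning

  length-concatMap≥ : ∀ {a xs} → All (λ x → a ≤ length (f x)) xs →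
                      length xs * a ≤ length (concatMap f xs)
  length-concatMap≥ [] = z≤n
  length-concatMap≥ {xs = x ∷ xs} (a≤fx ∷ a≤fxs) = begin
    _ + length xs * _                       ≤⟨ +-mono-≤ a≤fx (length-concatMap≥ a≤fxs) ⟩
    length (f x) + length (concatMap f xs)  ≡⟨ length-++ (f x) ⟨
    length (f x ++ concatMap f xs)          ∎
    where open ≤-Reasoning

  module _ {P : Pred A 0ℓ} (P? : Decidable P) where

    length-concatMap-filter≤ : ∀ xs → length (concatMap f (filter P? xs)) ≤ length (concatMap f xs)
    length-concatMap-filter≤ [] = z≤n
    length-concatMap-filter≤ (x ∷ xs) = begin
      length (concatMap f (filter P? (x ∷ xs)))  ≤⟨ count-x (P? x) ⟩
      length (f x) + length (concatMap f xs)     ≡⟨ length-++ (f x) ⟨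
      length (f x ++ concatMap f xs)             ∎
      where
      open ≤-Reasoning
      ih = length-concatMap-filter≤ xs
      count-x : Dec (P x) → length (concatMap f (filter P? (x ∷ xs))) ≤ length (f x) + length (concatMap f xs)
      count-x (yes Px) = begin
        length (concatMap f (filter P? (x ∷ xs)))           ≡⟨ cong (length ∘ concatMap f) (filter-accept P? Px) ⟩
        length (f x ++ concatMap f (filter P? xs))          ≡⟨ length-++ (f x) ⟩
        length (f x) + length (concatMap f (filter P? xs))  ≤⟨ +-monoʳ-≤ (length (f x)) ih ⟩
        _                                                   ∎
      count-x (no ¬Px) = begin
        length (concatMap f (filter P? (x ∷ xs)))  ≡⟨ cong (length ∘ concatMap f) (filter-reject P? ¬Px) ⟩
        length (concatMap f (filter P? xs))        ≤⟨ ih ⟩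
        length (concatMap f xs)                    ≤⟨ m≤n+m _ (length (f x)) ⟩
        _                                          ∎

  module _ {P : Pred B 0ℓ} (P? : Decidable P) where

    length-filter-any≤ : ∀ xs → length (filter (any? P? ∘ f) xs) ≤ length (filter P? (concatMap f xs))
    length-filter-any≤ [] = z≤n
    length-filter-any≤ (x ∷ xs) = begin
      length (filter (any? P? ∘ f) (x ∷ xs))                       ≤⟨ count-x (any? P? (f x)) ⟩
      length (filter P? (f x)) + length (filter P? (concatMap f xs)) ≡⟨ length-++ (filter P? (f x)) ⟨
      length (filter P? (f x) ++ filter P? (concatMap f xs))       ≡⟨ cong length (filter-++ P? (f x) _) ⟨
      length (filter P? (f x ++ concatMap f xs))                   ∎
      where
      open ≤-Reasoning
      ih = length-filter-any≤ xs
      count-x : Dec (Any P (f x)) →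
             length (filter (any? P? ∘ f) (x ∷ xs)) ≤ length (filter P? (f x)) + length (filter P? (concatMap f xs))
      count-x (yes meets) = begin
        length (filter (any? P? ∘ f) (x ∷ xs))  ≡⟨ cong length (filter-accept (any? P? ∘ f) meets) ⟩
        suc (length (filter (any? P? ∘ f) xs))  ≤⟨ +-mono-≤ (filter-some P? meets) ih ⟩
        _                                       ∎
      count-x (no misses) = begin
        length (filter (any? P? ∘ f) (x ∷ xs))  ≡⟨ cong length (filter-reject (any? P? ∘ f) misses) ⟩
        length (filter (any? P? ∘ f) xs)        ≤⟨ ih ⟩
        _                                       ≤⟨ m≤n+m _ _ ⟩
        _                                       ∎

module _ {A : Set} {P : Pred A 0ℓ} (P? : Decidable P) where

  length-filter-∷≥ : ∀ x xs → length (filter P? xs) ≤ length (filter P? (x ∷ xs))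
  length-filter-∷≥ x xs with does (P? x)
  ... | true  = n≤1+n _
  ... | false = ≤-refl

  length-filter-∘ : ∀ {B : Set} (g : B → A) xs →
                    length (filter (P? ∘ g) xs) ≡ length (filter P? (map g xs))
  length-filter-∘ g [] = refl
  length-filter-∘ g (x ∷ xs) with does (P? (g x))
  ... | true  = cong suc (length-filter-∘ g xs)
  ... | false = length-filter-∘ g xs

module _ {A : Set} {P Q S : Pred A 0ℓ} (P? : Decidable P) (Q? : Decidable Q) (S? : Decidable S) where

  length≤-cover : ∀ {xs} → All (λ x → P x ⊎ Q x ⊎ S x) xs →
                  length xs ≤ length (filter P? xs) + length (filter Q? xs) + length (filter S? xs)
  length≤-cover [] = z≤n
  length≤-cover {x ∷ xs} (cover-x ∷ cover) = [ viaP , [ viaQ , viaS ] ] cover-x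
    where
    open ≤-Reasoning
    #P = length (filter P? xs)
    #Q = length (filter Q? xs)
    #S = length (filter S? xs)
    ih : length xs ≤ #P + #Q + #S
    ih = length≤-cover cover
    accept : ∀ {R : Pred A 0ℓ} (R? : Decidable R) → R x →
             suc (length (filter R? xs)) ≤ length (filter R? (x ∷ xs))
    accept R? Rx = ≤-reflexive (sym (cong length (filter-accept R? Rx)))
    grow : ∀ {R : Pred A 0ℓ} (R? : Decidable R) → length (filter R? xs) ≤ length (filter R? (x ∷ xs))
    grow R? = length-filter-∷≥ R? x xs
    viaP : P x → suc (length xs) ≤ _
    viaP Px = begin
      suc (length xs)     ≤⟨ s≤s ih ⟩
      suc #P + #Q + #S    ≤⟨ +-mono-≤ (+-mono-≤ (accept P? Px) (grow Q?)) (grow S?) ⟩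
      _                   ∎
    viaQ : Q x → suc (length xs) ≤ _
    viaQ Qx = begin
      suc (length xs)     ≤⟨ s≤s ih ⟩
      suc (#P + #Q + #S)  ≡⟨ cong (_+ #S) (+-suc #P #Q) ⟨
      #P + suc #Q + #S    ≤⟨ +-mono-≤ (+-mono-≤ (grow P?) (accept Q? Qx)) (grow S?) ⟩
      _                   ∎
    viaS : S x → suc (length xs) ≤ _
    viaS Sx = begin
      suc (length xs)     ≤⟨ s≤s ih ⟩
      suc (#P + #Q + #S)  ≡⟨ +-suc (#P + #Q) #S ⟨
      #P + #Q + suc #S    ≤⟨ +-mono-≤ (+-mono-≤ (grow P?) (grow Q?)) (accept S? Sx) ⟩
      _                   ∎

⌊√⌋-spec : ∀ n → ∃[ a ] a * a ≤ n × n < suc a * suc a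
⌊√⌋-spec zero = 0 , z≤n , s≤s z≤n
⌊√⌋-spec (suc n) with ⌊√⌋-spec n
... | a , a²≤n , n<[1+a]² with suc a * suc a ≤? suc n
...   | yes [1+a]²≤1+n = suc a , [1+a]²≤1+n , ≤-<-trans n<[1+a]² (*-mono-< (n<1+n (suc a)) (n<1+n (suc a)))
...   | no  [1+a]²≰1+n = a , m≤n⇒m≤1+n a²≤n , ≰⇒> [1+a]²≰1+n

√-scale : ∀ m → ∃[ a ] 1 ≤ a × a * a ≤ suc m × suc m ≤ 4 * (a * a)
√-scale m with ⌊√⌋-spec (suc m)
... | zero    , _     , s≤s ()
... | a@(suc _) , a²≤n , n<[1+a]² = a , s≤s z≤n , a²≤n , (begin
  suc m              ≤⟨ <⇒≤ n<[1+a]² ⟩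
  suc a * suc a      ≤⟨ *-mono-≤ 1+a≤2a 1+a≤2a ⟩
  (a + a) * (a + a)  ≡⟨ [a+a]²≡4a² a ⟩
  4 * (a * a)        ∎)
  where
  open ≤-Reasoning
  1+a≤2a : suc a ≤ a + a
  1+a≤2a = +-monoˡ-≤ a (s≤s z≤n)
  [a+a]²≡4a² : ∀ a → (a + a) * (a + a) ≡ 4 * (a * a)
  [a+a]²≡4a² = solve-∀

charging-arithmetic : ∀ {a g m nL r} → 1 ≤ a → 1 ≤ g → a * a ≤ suc m → suc m ≤ 4 * (a * a) →
                      nL * a ≤ m → r ≤ nL + g + g * a → r * r ≤ 36 * suc m * (g * g)
charging-arithmetic {a} {g} {m} {nL} {r} 1≤a 1≤g a²≤1+m 1+m≤4a² nLa≤m r≤nL+g+ga = begin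
  r * r                        ≤⟨ *-mono-≤ r≤6ag r≤6ag ⟩
  6 * (a * g) * (6 * (a * g))  ≡⟨ square a g ⟩
  36 * (a * a) * (g * g)       ≤⟨ *-monoˡ-≤ (g * g) (*-monoʳ-≤ 36 a²≤1+m) ⟩
  36 * suc m * (g * g)         ∎
  where
  open ≤-Reasoning
  square : ∀ a g → 6 * (a * g) * (6 * (a * g)) ≡ 36 * (a * a) * (g * g)
  square = solve-∀
  collect : ∀ a g → 4 * a * g + g * a + g * a ≡ 6 * (a * g)
  collect = solve-∀
  nL<4a : nL < 4 * a
  nL<4a = *-cancelʳ-< a nL (4 * a) (begin-strict
    nL * a       ≤⟨ nLa≤m ⟩
    m            <⟨ n<1+n m ⟩
    suc m        ≤⟨ 1+m≤4a² ⟩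
    4 * (a * a)  ≡⟨ *-assoc 4 a a ⟨
    4 * a * a    ∎)
  r≤6ag : r ≤ 6 * (a * g)
  r≤6ag = begin
    r                          ≤⟨ r≤nL+g+ga ⟩
    nL + g + g * a             ≤⟨ +-monoˡ-≤ (g * a) (+-mono-≤ (≤-trans (<⇒≤ nL<4a) (m≤m*n (4 * a) g {{>-nonZero 1≤g}}))
                                                               (m≤m*n g a {{>-nonZero 1≤a}})) ⟩
    4 * a * g + g * a + g * a  ≡⟨ collect a g ⟩
    6 * (a * g)                ∎

module _ (I : Instance) where
  open Instance I
  open DecMembership (Fin._≟_ {m}) using () renaming (_∈?_ to _∈ₑ?_)

  -- While p misses the chosen paths it stays feasible in the residual graph, so the first chosen path it
  -- meets was preferred to it and is no longer.
  greedy-blocks : ∀ {D U run} → GreedyFrom I D U run →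
                  ∀ {d p} → d ∉ D → d ∉ map proj₁ run → Feasible I d U p →
                  ∃[ y ] y ∈ run × length (proj₂ y) ≤ length p × Any (_∈ proj₂ y) p
  greedy-blocks (done stuck) d∉D _ feasible = ⊥-elim (stuck _ d∉D _ feasible)
  greedy-blocks {D} (step {d = d₁} {p = p₁} _ _ shortest rest) {d} {p} d∉D d∉run
                feasible@(walk , simple , allowed , avoidsU) with any? (_∈ₑ? p₁) p
  ... | yes meets = (d₁ , p₁) , here refl , shortest d d∉D p feasible , meets
  ... | no misses =
    let y , y∈rest , shorter , meets = greedy-blocks rest d∉d₁∷D (d∉run ∘ there) feasible′
    in  y , there y∈rest , shorter , meets
    where
    d∉d₁∷D : d ∉ d₁ ∷ D
    d∉d₁∷D = [ d∉run ∘ here , d∉D ] ∘ Any.toSum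
    feasible′ : Feasible I d (p₁ ++ _) p
    feasible′ = walk , simple , allowed , All.zipWith (λ (∉p₁ , ∉U) → ∉-++⁺ ∉p₁ ∉U) (¬Any⇒All¬ p misses , avoidsU)

module Charging (I : Instance) {G} (run : GreedyRun I G) (a : ℕ) where
  open Instance I
  open DecMembership (Fin._≟_ {k}) using () renaming (_∈?_ to _∈ᵈ?_)
  open DecMembership (Fin._≟_ {m}) using () renaming (_∈?_ to _∈ₑ?_)

  Route : Set
  Route = Fin k × List (Fin m)

  short? long? : Decidable {A = Route} _
  short? y = length (proj₂ y) <? a
  long?  y = a ≤? length (proj₂ y)

  routed? : Decidable {A = Route} _
  routed? = (_∈ᵈ? map proj₁ G) ∘ proj₁

  shortEdges : List (Fin m)
  shortEdges = concatMap proj₂ (filter short? G)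

  meets-short? : Decidable {A = Route} _
  meets-short? = any? (_∈ₑ? shortEdges) ∘ proj₂

  classify : ∀ {y} → Feasible I (proj₁ y) [] (proj₂ y) →
             a ≤ length (proj₂ y) ⊎ proj₁ y ∈ map proj₁ G ⊎ Any (_∈ shortEdges) (proj₂ y)
  classify {d , p} feasible with a ≤? length p | d ∈ᵈ? map proj₁ G
  ... | yes long | _          = inj₁ long
  ... | no _     | yes routed = inj₂ (inj₁ routed)
  ... | no ¬long | no unrouted =
    let y , y∈G , shorter , meets = greedy-blocks I run (λ ()) unrouted feasible
        y∈short = ∈-filter⁺ short? y∈G (≤-<-trans shorter (≰⇒> ¬long))
    in  inj₂ (inj₂ (Any.map (λ e∈y → ∈-concat⁺′ e∈y (∈-map⁺ proj₂ y∈short)) meets))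

  length-routing≤ : ∀ {R} → Routing I R → ∃[ nL ] nL * a ≤ m × length R ≤ nL + length G + length G * a
  length-routing≤ {R} (distinct , disjoint , feasible) = length (filter long? R) , long-bound , (begin
    length R                   ≤⟨ length≤-cover long? routed? meets-short? (All.map classify feasible) ⟩
    length (filter long? R) + length (filter routed? R) + length (filter meets-short? R)
                               ≤⟨ +-mono-≤ (+-monoʳ-≤ _ routed-bound) meets-bound ⟩
    _ + length G + length G * a ∎)
    where
    open ≤-Reasoning
    long-bound : length (filter long? R) * a ≤ m
    long-bound = begin
      length (filter long? R) * a                ≤⟨ length-concatMap≥ proj₂ (all-filter long? R) ⟩
      length (concatMap proj₂ (filter long? R))  ≤⟨ length-concatMap-filter≤ proj₂ long? R ⟩
      length (concatMap proj₂ R)                 ≤⟨ unique⇒length≤card disjoint ⟩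
      m                                          ∎
    routed-bound : length (filter routed? R) ≤ length G
    routed-bound = begin
      length (filter routed? R)                          ≡⟨ length-filter-∘ (_∈ᵈ? map proj₁ G) proj₁ R ⟩
      length (filter (_∈ᵈ? map proj₁ G) (map proj₁ R))  ≤⟨ length-filter-∈≤ Fin._≟_ (map proj₁ G) distinct ⟩
      length (map proj₁ G)                               ≡⟨ length-map proj₁ G ⟩
      length G                                           ∎
    meets-bound : length (filter meets-short? R) ≤ length G * a
    meets-bound = begin
      length (filter meets-short? R)                          ≤⟨ length-filter-any≤ proj₂ (_∈ₑ? shortEdges) R ⟩
      length (filter (_∈ₑ? shortEdges) (concatMap proj₂ R))  ≤⟨ length-filter-∈≤ Fin._≟_ shortEdges disjoint ⟩
      length shortEdges                                       ≤⟨ length-concatMap≤ proj₂ (All.map <⇒≤ (all-filter short? G)) ⟩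
      length (filter short? G) * a                            ≤⟨ *-monoˡ-≤ a (length-filter short? G) ⟩
      length G * a                                            ∎

greedy-√m-approximation : (I : Instance) →
    (G : List (Fin (Instance.k I) × List (Fin (Instance.m I)))) → GreedyRun I G →
    (R : List (Fin (Instance.k I) × List (Fin (Instance.m I)))) → Routing I R →
    length R * length R ≤ 36 * suc (Instance.m I) * (length G * length G)
greedy-√m-approximation I [] run [] _ = z≤n
greedy-√m-approximation I [] run (_ ∷ _) (_ , _ , feasible ∷ _)
  with () ← proj₁ (proj₂ (greedy-blocks I run (λ ()) (λ ()) feasible))
greedy-√m-approximation I G@(_ ∷ _) run R routing =
  let a , 1≤a , a²≤1+m , 1+m≤4a² = √-scale (Instance.m I)
      nL , nLa≤m , R≤nL+G+Ga     = Charging.length-routing≤ I run a routing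
  in  charging-arithmetic {nL = nL} {r = length R} 1≤a (s≤s z≤n) a²≤1+m 1+m≤4a² nLa≤m R≤nL+G+Ga

lemma16 : Σ ℕ λ C → (I : Instance) →
            (G : List (Fin (Instance.k I) × List (Fin (Instance.m I)))) → GreedyRun I G →
            (R : List (Fin (Instance.k I) × List (Fin (Instance.m I)))) → Routing I R →
            length R * length R ≤ C * suc (Instance.m I) * (length G * length G)
lemma16 = 36 , greedy-√m-approximation
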